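{- Let $Q$ be any mutation-cyclic quiver on three vertices. Then no ice quiver obtained from the framed quiver $\widehat Q$ by a sequence of mutations has all of its mutable vertices red. Consequently, $Q$ does not admit a reddening sequence.
   Context: Quivers have no loops or 2-cycles. Mutation at a (mutable) vertex $k$: add an arrow $a\to b$ for each path $a\to k\to b$, reverse all arrows at $k$, remove 2-cycles. A quiver is mutation-cyclic if no quiver obtained from it by a sequence of mutations is acyclic (has no directed cycle). The framed quiver $\widehat Q$ is the ice quiver obtained by adding, for each vertex $i$ of $Q$, a frozen vertex $i'$ and one arrow $i\to i'$; mutations are only at the original (mutable) vertices. A mutable vertex is red if it has at least one arrow to/from a frozen vertex and all such arrows point from frozen vertices into it. A reddening sequence for $Q$ is a mutation sequence $\mathbf w$ such that every mutable vertex of $\mu_{\mathbf w}(\widehat Q)$ is red. -}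

module Defs where

open import Data.Nat using (ℕ; zero; suc; _+_; _*_; _∸_; _<_)
open import Data.Fin using (Fin)
open import Data.Fin.Properties renaming (_≟_ to _≟ᶠ_)
open import Data.Sum using (_⊎_; inj₁; inj₂)
open import Data.Sum.Properties using (≡-dec)
open import Data.Product using (Σ; _×_; ∃; _,_)
open import Data.List using (List; []; _∷_; map)
open import Data.Empty using (⊥)
open import Relation.Nullary using (¬_; yes; no)
open import Relation.Binary.PropositionalEquality using (_≡_; _≢_)
open import Relation.Binary.Definitions using (DecidableEquality)

-- A (raw) quiver on vertex set V: arrows a b = number of arrows a → b.
Quiver : Set → Set
Quiver V = V → V → ℕ

IsQuiver : {V : Set} → Quiver V → Set
IsQuiver {V} Q = (∀ a → Q a a ≡ 0) × (∀ a b → Q a b ≡ 0 ⊎ Q b a ≡ 0)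

-- Mutation at vertex k (as in the paper):
--  * for a, b ≠ k: add Q a k * Q k b arrows a → b (one per path a → k → b),
--    then cancel 2-cycles: the net count a → b is
--    (Q a b + Q a k * Q k b) ∸ (Q b a + Q b k * Q k a);
--  * arrows at k are reversed.
mutate : {V : Set} → DecidableEquality V → Quiver V → V → Quiver V
mutate _≟_ Q k a b with a ≟ k | b ≟ k
... | yes _ | _     = Q b a
... | no _  | yes _ = Q b a
... | no _  | no _  = (Q a b + Q a k * Q k b) ∸ (Q b a + Q b k * Q k a)

mutateSeq : {V : Set} → DecidableEquality V → List V → Quiver V → Quiver V
mutateSeq _≟_ []       Q = Q
mutateSeq _≟_ (k ∷ ks) Q = mutateSeq _≟_ ks (mutate _≟_ Q k)

data Path {V : Set} (Q : Quiver V) : V → V → Set where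
  edge : ∀ {a b} → 0 < Q a b → Path Q a b
  step : ∀ {a b c} → 0 < Q a b → Path Q b c → Path Q a c

HasDirectedCycle : {V : Set} → Quiver V → Set
HasDirectedCycle {V} Q = Σ V λ a → Path Q a a

Acyclic : {V : Set} → Quiver V → Set
Acyclic Q = ¬ HasDirectedCycle Q

Q3 : Set
Q3 = Quiver (Fin 3)

mutateSeq3 : List (Fin 3) → Q3 → Q3
mutateSeq3 = mutateSeq _≟ᶠ_

MutationCyclic : Q3 → Set
MutationCyclic Q = ∀ (ws : List (Fin 3)) → ¬ Acyclic (mutateSeq3 ws Q)

-- Ice quivers with mutable vertices inj₁ i and frozen vertices inj₂ i.
IceV : ℕ → Set
IceV n = Fin n ⊎ Fin n

_≟ᴵ_ : {n : ℕ} → DecidableEquality (IceV n)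
_≟ᴵ_ = ≡-dec _≟ᶠ_ _≟ᶠ_

framed : {n : ℕ} → Quiver (Fin n) → Quiver (IceV n)
framed Q (inj₁ i) (inj₁ j) = Q i j
framed Q (inj₁ i) (inj₂ j) with i ≟ᶠ j
... | yes _ = 1
... | no _  = 0
framed Q (inj₂ i) _ = 0

mutateIce : {n : ℕ} → List (Fin n) → Quiver (IceV n) → Quiver (IceV n)
mutateIce ws = mutateSeq _≟ᴵ_ (map inj₁ ws)

Red : {n : ℕ} → Quiver (IceV n) → Fin n → Set
Red {n} R i =
  (Σ (Fin n) λ j → (0 < R (inj₂ j) (inj₁ i)) ⊎ (0 < R (inj₁ i) (inj₂ j)))
  × (∀ (j : Fin n) → R (inj₁ i) (inj₂ j) ≡ 0)

AllRed : {n : ℕ} → Quiver (IceV n) → Set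
AllRed {n} R = ∀ (i : Fin n) → Red R i

IsReddeningSequence : {n : ℕ} → Quiver (Fin n) → List (Fin n) → Set
IsReddeningSequence Q ws = AllRed (mutateIce ws (framed Q))

AdmitsReddeningSequence : {n : ℕ} → Quiver (Fin n) → Set
AdmitsReddeningSequence {n} Q = Σ (List (Fin n)) λ ws → IsReddeningSequence Q ws

module Submission where

-- Mutating twice at a vertex is the identity, so it suffices to consider reduced mutation
-- sequences, with no letter repeated consecutively. Since every mutation of Q is cyclic, the
-- mutable part of every seed is an oriented 3-cycle k → s → p → k with weights a = #(k→s),
-- b = #(s→p), c = #(p→k) satisfying c < ab, a < bc, b < ca (each one says that mutating at
-- a vertex keeps the quiver cyclic), hence a, b, c ≥ 2. Let k be the vertex mutated last.
-- For each frozen vertex, the signed arrow counts between it and k, s, p lie in one of two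
-- cones, both of which force s to receive no arrow from a frozen vertex, so s is not red.
-- The weights being at least 2 is exactly what carries the cones through the next mutation,
-- at s or at p; the first mutation, of the framed quiver, lands in a cone as well.

open import Defs
open import Data.Nat using (ℕ; zero; suc; _+_; _*_; _∸_; _≤_; _<_; z≤n; s≤s; >-nonZero)
open import Data.Nat.Properties
open import Data.Fin using (Fin; zero; suc)
open import Data.Fin.Properties using (all?) renaming (_≟_ to _≟ᶠ_)
open import Data.List using (List; []; _∷_; map; foldr)
open import Data.List.Relation.Unary.Linked as Linked using (Linked; []; [-]; _∷_)
open import Data.Product using (∃; ∃₂; _×_; _,_; proj₁; proj₂)
open import Data.Sum using (_⊎_; inj₁; inj₂)
open import Data.Sum.Properties using (inj₁-injective)
open import Data.Empty using (⊥-elim)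
open import Function using (_∘_)
open import Relation.Nullary using (¬_; Dec; yes; no)
open import Relation.Nullary.Decidable using (toWitness; ¬?; _×-dec_; _⊎-dec_; _→-dec_)
open import Relation.Binary.PropositionalEquality
open import Relation.Binary.Definitions using (DecidableEquality)

infix 4 _≈_

_≈_ : {V : Set} → Quiver V → Quiver V → Set
Q ≈ Q′ = ∀ a b → Q a b ≡ Q′ a b

≈-sym : {V : Set} {Q Q′ : Quiver V} → Q ≈ Q′ → Q′ ≈ Q
≈-sym Q≈Q′ a b = sym (Q≈Q′ a b)

≈-trans : {V : Set} {Q Q′ Q″ : Quiver V} → Q ≈ Q′ → Q′ ≈ Q″ → Q ≈ Q″
≈-trans Q≈Q′ Q′≈Q″ a b = trans (Q≈Q′ a b) (Q′≈Q″ a b)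

∸-dichotomy : ∀ m n → m ∸ n ≡ 0 ⊎ n ∸ m ≡ 0
∸-dichotomy m n with ≤-total m n
... | inj₁ m≤n = inj₁ (m≤n⇒m∸n≡0 m≤n)
... | inj₂ n≤m = inj₂ (m≤n⇒m∸n≡0 n≤m)

∸-balance : ∀ m n → (m ∸ n) + n ≡ (n ∸ m) + m
∸-balance m n with ≤-total m n
... | inj₁ m≤n = trans (cong (_+ n) (m≤n⇒m∸n≡0 m≤n)) (sym (m∸n+n≡m m≤n))
... | inj₂ n≤m = trans (m∸n+n≡m n≤m) (cong (_+ m) (sym (m≤n⇒m∸n≡0 n≤m)))

∸-cancel : ∀ u v x y → u + y ≡ v + x → u ∸ v ≡ x ∸ y
∸-cancel u v x y eq = begin
  u ∸ v             ≡⟨ sym ([m+n]∸[m+o]≡n∸o y u v) ⟩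
  (y + u) ∸ (y + v) ≡⟨ cong₂ _∸_ (+-comm y u) (+-comm y v) ⟩
  (u + y) ∸ (v + y) ≡⟨ cong (_∸ (v + y)) eq ⟩
  (v + x) ∸ (v + y) ≡⟨ [m+n]∸[m+o]≡n∸o v x y ⟩
  x ∸ y             ∎
  where open ≡-Reasoning

-- The count of a → b after mutating twice at k, with P = #(a→k→b) and P′ = #(b→k→a).
∸-twice : ∀ x y P P′ → (((x + P) ∸ (y + P′)) + P′) ∸ (((y + P′) ∸ (x + P)) + P) ≡ x ∸ y
∸-twice x y P P′ = ∸-cancel ((X ∸ Y) + P′) ((Y ∸ X) + P) x y (begin
  ((X ∸ Y) + P′) + y ≡⟨ +-assoc (X ∸ Y) P′ y ⟩
  (X ∸ Y) + (P′ + y) ≡⟨ cong ((X ∸ Y) +_) (+-comm P′ y) ⟩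
  (X ∸ Y) + Y        ≡⟨ ∸-balance X Y ⟩
  (Y ∸ X) + X        ≡⟨ cong ((Y ∸ X) +_) (+-comm x P) ⟩
  (Y ∸ X) + (P + x)  ≡⟨ sym (+-assoc (Y ∸ X) P x) ⟩
  ((Y ∸ X) + P) + x  ∎)
  where
  open ≡-Reasoning
  X = x + P
  Y = y + P′

n+n≤a*n : ∀ {a} n → 2 ≤ a → n + n ≤ a * n
n+n≤a*n n 2≤a = ≤-trans (≤-reflexive (cong (n +_) (sym (+-identityʳ n)))) (*-monoˡ-≤ n 2≤a)

n≤a*n : ∀ {a} n → 0 < a → n ≤ a * n
n≤a*n {a} n 0<a = m≤n*m n a {{>-nonZero 0<a}}

n+n≤n*a : ∀ {a} n → 2 ≤ a → n + n ≤ n * a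
n+n≤n*a {a} n 2≤a = subst (n + n ≤_) (*-comm a n) (n+n≤a*n n 2≤a)

2≤weight : ∀ {a b c} → c < a * b → b < c * a → 2 ≤ a
2≤weight {zero}        c<0 _   = ⊥-elim (n≮0 c<0)
2≤weight {suc zero} {b} {c} c<b b<c =
  ⊥-elim (<-asym (subst (c <_) (*-identityˡ b) c<b) (subst (b <_) (*-identityʳ c) b<c))
2≤weight {suc (suc _)} _   _   = s≤s (s≤s z≤n)

-- Mutation

module Mutation {V : Set} (_≟_ : DecidableEquality V) where

  mutate-out : (Q : Quiver V) (k b : V) → mutate _≟_ Q k k b ≡ Q b k
  mutate-out Q k b with k ≟ k
  ... | yes _   = refl
  ... | no k≢k = ⊥-elim (k≢k refl)

  mutate-in : (Q : Quiver V) (k a : V) → mutate _≟_ Q k a k ≡ Q k a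
  mutate-in Q k a with a ≟ k | k ≟ k
  ... | yes _ | _       = refl
  ... | no _  | yes _   = refl
  ... | no _  | no k≢k = ⊥-elim (k≢k refl)

  mutate-away : (Q : Quiver V) {k a b : V} → a ≢ k → b ≢ k →
    mutate _≟_ Q k a b ≡ (Q a b + Q a k * Q k b) ∸ (Q b a + Q b k * Q k a)
  mutate-away Q {k} {a} {b} a≢k b≢k with a ≟ k | b ≟ k
  ... | yes a≡k | _       = ⊥-elim (a≢k a≡k)
  ... | no _    | yes b≡k = ⊥-elim (b≢k b≡k)
  ... | no _    | no _    = refl

  mutate-resp-≈ : {Q Q′ : Quiver V} (k : V) → Q ≈ Q′ → mutate _≟_ Q k ≈ mutate _≟_ Q′ k
  mutate-resp-≈ {Q} {Q′} k Q≈Q′ a b with a ≟ k | b ≟ k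
  ... | yes _ | _     = Q≈Q′ b a
  ... | no _  | yes _ = Q≈Q′ b a
  ... | no _  | no _  =
    cong₂ _∸_ (cong₂ _+_ (Q≈Q′ a b) (cong₂ _*_ (Q≈Q′ a k) (Q≈Q′ k b)))
              (cong₂ _+_ (Q≈Q′ b a) (cong₂ _*_ (Q≈Q′ b k) (Q≈Q′ k a)))

  mutateSeq-resp-≈ : {Q Q′ : Quiver V} (ws : List V) → Q ≈ Q′ →
    mutateSeq _≟_ ws Q ≈ mutateSeq _≟_ ws Q′
  mutateSeq-resp-≈ []       Q≈Q′ = Q≈Q′
  mutateSeq-resp-≈ (k ∷ ws) Q≈Q′ = mutateSeq-resp-≈ ws (mutate-resp-≈ k Q≈Q′)

  mutate-isQuiver : {Q : Quiver V} (k : V) → IsQuiver Q → IsQuiver (mutate _≟_ Q k)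
  mutate-isQuiver {Q} k (loop-free , no-2-cycle) = loop-free′ , no-2-cycle′
    where
    loop-free′ : ∀ a → mutate _≟_ Q k a a ≡ 0
    loop-free′ a with a ≟ k
    ... | yes _ = loop-free a
    ... | no _  = n∸n≡0 (Q a a + Q a k * Q k a)
    swap : ∀ {m n : ℕ} → m ≡ 0 ⊎ n ≡ 0 → n ≡ 0 ⊎ m ≡ 0
    swap (inj₁ m≡0) = inj₂ m≡0
    swap (inj₂ n≡0) = inj₁ n≡0
    no-2-cycle′ : ∀ a b → mutate _≟_ Q k a b ≡ 0 ⊎ mutate _≟_ Q k b a ≡ 0
    no-2-cycle′ a b with a ≟ k | b ≟ k
    ... | yes _ | yes _ = swap (no-2-cycle a b)
    ... | yes _ | no _  = swap (no-2-cycle a b)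
    ... | no _  | yes _ = swap (no-2-cycle a b)
    ... | no _  | no _  = ∸-dichotomy (Q a b + Q a k * Q k b) (Q b a + Q b k * Q k a)

  mutate-involutive : {Q : Quiver V} (k : V) → IsQuiver Q → mutate _≟_ (mutate _≟_ Q k) k ≈ Q
  mutate-involutive {Q} k (_ , no-2-cycle) a b with a ≟ k | b ≟ k
  ... | yes refl | _        = mutate-in Q a b
  ... | no _     | yes refl = mutate-out Q b a
  ... | no a≢k   | no b≢k   = begin
    (M a b + M a k * M k b) ∸ (M b a + M b k * M k a)
      ≡⟨ cong₂ _∸_ (cong₂ _+_ (mutate-away Q a≢k b≢k) (cong₂ _*_ (mutate-in Q k a) (mutate-out Q k b)))
                   (cong₂ _+_ (mutate-away Q b≢k a≢k) (cong₂ _*_ (mutate-in Q k b) (mutate-out Q k a))) ⟩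
    (((x + P) ∸ (y + P′)) + Q k a * Q b k) ∸ (((y + P′) ∸ (x + P)) + Q k b * Q a k)
      ≡⟨ cong₂ (λ m n → (((x + P) ∸ (y + P′)) + m) ∸ (((y + P′) ∸ (x + P)) + n))
               (*-comm (Q k a) (Q b k)) (*-comm (Q k b) (Q a k)) ⟩
    (((x + P) ∸ (y + P′)) + P′) ∸ (((y + P′) ∸ (x + P)) + P)
      ≡⟨ ∸-twice x y P P′ ⟩
    x ∸ y
      ≡⟨ ∸-of-orthogonal (no-2-cycle a b) ⟩
    x ∎
    where
    open ≡-Reasoning
    M = mutate _≟_ Q k
    x = Q a b
    y = Q b a
    P = Q a k * Q k b
    P′ = Q b k * Q k a
    ∸-of-orthogonal : x ≡ 0 ⊎ y ≡ 0 → x ∸ y ≡ x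
    ∸-of-orthogonal (inj₁ x≡0) = trans (cong (_∸ y) x≡0) (trans (0∸n≡0 y) (sym x≡0))
    ∸-of-orthogonal (inj₂ y≡0) = cong (x ∸_) y≡0

-- Reduced mutation sequences

module Reduction {K V : Set} (_≟ᴷ_ : DecidableEquality K) (_≟_ : DecidableEquality V) (ι : K → V) where
  open Mutation _≟_

  infixr 5 _∷ᶜ_

  _∷ᶜ_ : K → List K → List K
  k ∷ᶜ []       = k ∷ []
  k ∷ᶜ (l ∷ ws) with k ≟ᴷ l
  ... | yes _ = ws
  ... | no _  = k ∷ l ∷ ws

  reduce : List K → List K
  reduce = foldr _∷ᶜ_ []

  ∷ᶜ-linked : (k : K) {ws : List K} → Linked _≢_ ws → Linked _≢_ (k ∷ᶜ ws)
  ∷ᶜ-linked k {[]}     _      = [-]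
  ∷ᶜ-linked k {l ∷ ws} linked with k ≟ᴷ l
  ... | yes _  = Linked.tail linked
  ... | no k≢l = k≢l ∷ linked

  reduce-linked : (ws : List K) → Linked _≢_ (reduce ws)
  reduce-linked []       = []
  reduce-linked (k ∷ ws) = ∷ᶜ-linked k (reduce-linked ws)

  mutateSeq-∷ᶜ : {Q : Quiver V} (k : K) (ws : List K) → IsQuiver Q →
    mutateSeq _≟_ (map ι (k ∷ ws)) Q ≈ mutateSeq _≟_ (map ι (k ∷ᶜ ws)) Q
  mutateSeq-∷ᶜ k []       _ = λ _ _ → refl
  mutateSeq-∷ᶜ k (l ∷ ws) isQ with k ≟ᴷ l
  ... | yes refl = mutateSeq-resp-≈ (map ι ws) (mutate-involutive (ι k) isQ)
  ... | no _     = λ _ _ → refl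

  mutateSeq-reduce : {Q : Quiver V} (ws : List K) → IsQuiver Q →
    mutateSeq _≟_ (map ι ws) Q ≈ mutateSeq _≟_ (map ι (reduce ws)) Q
  mutateSeq-reduce []       _   = λ _ _ → refl
  mutateSeq-reduce (k ∷ ws) isQ =
    ≈-trans (mutateSeq-reduce ws (mutate-isQuiver (ι k) isQ)) (mutateSeq-∷ᶜ k (reduce ws) isQ)

-- Directed cycles

Acyclic-resp-≈ : {V : Set} {Q Q′ : Quiver V} → Q ≈ Q′ → Acyclic Q → Acyclic Q′
Acyclic-resp-≈ {Q = Q} {Q′} Q≈Q′ acyclic (a , cycle) = acyclic (a , back cycle)
  where
  back : ∀ {a b} → Path Q′ a b → Path Q a b
  back (edge {a} {b} a→b)   = edge (subst (0 <_) (sym (Q≈Q′ a b)) a→b)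
  back (step {a} {b} a→b p) = step (subst (0 <_) (sym (Q≈Q′ a b)) a→b) (back p)

no-path-from-sink : {V : Set} {Q : Quiver V} {v b : V} → (∀ c → Q v c ≡ 0) → ¬ Path Q v b
no-path-from-sink sink (edge {b = c} v→c)   = >⇒≢ v→c (sink c)
no-path-from-sink sink (step {b = c} v→c _) = >⇒≢ v→c (sink c)

no-path-into-source : {V : Set} {Q : Quiver V} {a v : V} → (∀ c → Q c v ≡ 0) → ¬ Path Q a v
no-path-into-source source (edge {a = c} c→v) = >⇒≢ c→v (source c)
no-path-into-source source (step _ p)         = no-path-into-source source p

-- Quivers on three vertices

Distinct : {A : Set} → A → A → A → Set
Distinct x y z = x ≢ y × y ≢ z × x ≢ z

covered? : Dec ((x y z v : Fin 3) → Distinct x y z → v ≡ x ⊎ v ≡ y ⊎ v ≡ z)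
covered? = all? λ x → all? λ y → all? λ z → all? λ v →
  (¬? (x ≟ᶠ y) ×-dec ¬? (y ≟ᶠ z) ×-dec ¬? (x ≟ᶠ z)) →-dec
  (v ≟ᶠ x ⊎-dec v ≟ᶠ y ⊎-dec v ≟ᶠ z)

-- Kept opaque so that case splits on it do not unfold the decision procedure.
opaque
  covers : {x y z : Fin 3} → Distinct x y z → ∀ v → v ≡ x ⊎ v ≡ y ⊎ v ≡ z
  covers {x} {y} {z} d v = toWitness {a? = covered?} _ x y z v d

ordered⇒acyclic : {M : Q3} {u v w : Fin 3} → Distinct u v w → (∀ a → M a a ≡ 0) →
  M v u ≡ 0 → M w u ≡ 0 → M w v ≡ 0 → Acyclic M
ordered⇒acyclic {M} {u} {v} {w} d loop-free v↛u w↛u w↛v (a , cycle) = no-cycle a cycle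
  where
  source : ∀ c → M c u ≡ 0
  source c with covers d c
  ... | inj₁ refl        = loop-free u
  ... | inj₂ (inj₁ refl) = v↛u
  ... | inj₂ (inj₂ refl) = w↛u
  sink : ∀ c → M w c ≡ 0
  sink c with covers d c
  ... | inj₁ refl        = w↛u
  ... | inj₂ (inj₁ refl) = w↛v
  ... | inj₂ (inj₂ refl) = loop-free w
  -- the only arrows out of v go to the sink w
  no-cycle-at-v : ¬ Path M v v
  no-cycle-at-v (edge v→v) = >⇒≢ v→v (loop-free v)
  no-cycle-at-v (step {b = c} v→c p) with covers d c
  ... | inj₁ refl        = >⇒≢ v→c v↛u
  ... | inj₂ (inj₁ refl) = >⇒≢ v→c (loop-free v)
  ... | inj₂ (inj₂ refl) = no-path-from-sink sink p
  no-cycle : ∀ a → ¬ Path M a a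
  no-cycle a with covers d a
  ... | inj₁ refl        = no-path-into-source source
  ... | inj₂ (inj₁ refl) = no-cycle-at-v
  ... | inj₂ (inj₂ refl) = no-path-from-sink sink

module Mᶠ = Mutation (_≟ᶠ_ {3})

cyclic-orientation : {M : Q3} {k s p : Fin 3} → IsQuiver M → ¬ Acyclic M → Distinct k s p →
  M s k ≡ 0 → M p s ≡ 0 × M k p ≡ 0
cyclic-orientation {M} {k} {s} {p} (loop-free , no-2-cycle) cyclic (k≢s , s≢p , k≢p) s↛k
  with no-2-cycle s p | no-2-cycle p k
... | inj₁ s↛p | _        = ⊥-elim (cyclic (s-is-sink (no-2-cycle k p)))
  where
  s-is-sink : M k p ≡ 0 ⊎ M p k ≡ 0 → Acyclic M
  s-is-sink (inj₁ k↛p) = ordered⇒acyclic (≢-sym k≢p , k≢s , ≢-sym s≢p) loop-free k↛p s↛p s↛k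
  s-is-sink (inj₂ p↛k) = ordered⇒acyclic (k≢p , ≢-sym s≢p , k≢s) loop-free p↛k s↛k s↛p
... | inj₂ p↛s | inj₁ p↛k =
  ⊥-elim (cyclic (ordered⇒acyclic (k≢s , s≢p , k≢p) loop-free s↛k p↛k p↛s))
... | inj₂ p↛s | inj₂ k↛p = p↛s , k↛p

cyclic-positive : {M : Q3} {k s p : Fin 3} → IsQuiver M → ¬ Acyclic M → Distinct k s p →
  M s k ≡ 0 → 0 < M s p
cyclic-positive isQ@(loop-free , _) cyclic d@(k≢s , s≢p , k≢p) s↛k =
  n≢0⇒n>0 λ s↛p →
    cyclic (ordered⇒acyclic (≢-sym k≢p , k≢s , ≢-sym s≢p) loop-free k↛p s↛p s↛k)
  where
  k↛p = proj₂ (cyclic-orientation isQ cyclic d s↛k)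

mutation-bound : {M : Q3} {k s p : Fin 3} → IsQuiver M → ¬ Acyclic (mutate _≟ᶠ_ M s) →
  Distinct k s p → M s k ≡ 0 → M p s ≡ 0 → M k p ≡ 0 → M p k < M k s * M s p
mutation-bound {M} {k} {s} {p} isQ cyclic (k≢s , s≢p , k≢p) s↛k p↛s k↛p =
  m∸n≢0⇒n<m (>⇒≢ (subst (0 <_) k→p-after positive))
  where
  positive : 0 < mutate _≟ᶠ_ M s k p
  positive = cyclic-positive (Mᶠ.mutate-isQuiver s isQ) cyclic (≢-sym k≢s , k≢p , s≢p)
    (trans (Mᶠ.mutate-in M s k) s↛k)
  k→p-after : mutate _≟ᶠ_ M s k p ≡ M k s * M s p ∸ M p k
  k→p-after = trans (Mᶠ.mutate-away M k≢s (≢-sym s≢p))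
    (cong₂ _∸_ (cong (_+ M k s * M s p) k↛p)
               (trans (cong (λ m → M p k + m * M s k) p↛s) (+-identityʳ (M p k))))

record Triangle (M : Q3) (k s p : Fin 3) : Set where
  field
    distinct : Distinct k s p
    s↛k : M s k ≡ 0
    p↛s : M p s ≡ 0
    k↛p : M k p ≡ 0
    2≤k→s : 2 ≤ M k s
    2≤s→p : 2 ≤ M s p
    2≤p→k : 2 ≤ M p k

triangle : {M : Q3} {k s p : Fin 3} → IsQuiver M → MutationCyclic M → Distinct k s p →
  M s k ≡ 0 → Triangle M k s p
triangle {M} {k} {s} {p} isQ cyclic d@(k≢s , s≢p , k≢p) s↛k = record
  { distinct = d ; s↛k = s↛k ; p↛s = p↛s ; k↛p = k↛p
  ; 2≤k→s = 2≤weight c<ab b<ca ; 2≤s→p = 2≤weight a<bc c<ab ; 2≤p→k = 2≤weight b<ca a<bc }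
  where
  orientation = cyclic-orientation isQ (cyclic []) d s↛k
  p↛s = proj₁ orientation
  k↛p = proj₂ orientation
  c<ab : M p k < M k s * M s p
  c<ab = mutation-bound isQ (cyclic (s ∷ [])) d s↛k p↛s k↛p
  a<bc : M k s < M s p * M p k
  a<bc = mutation-bound isQ (cyclic (p ∷ [])) (s≢p , ≢-sym k≢p , ≢-sym k≢s) p↛s k↛p s↛k
  b<ca : M s p < M p k * M k s
  b<ca = mutation-bound isQ (cyclic (k ∷ [])) (≢-sym k≢p , k≢s , ≢-sym s≢p) k↛p s↛k p↛s

others : (s : Fin 3) → ∃₂ λ y z → Distinct s y z
others zero             = suc zero , suc (suc zero) , (λ ()) , (λ ()) , (λ ())
others (suc zero)       = zero , suc (suc zero) , (λ ()) , (λ ()) , (λ ())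
others (suc (suc zero)) = zero , suc zero , (λ ()) , (λ ()) , (λ ())

triangle-through : {M : Q3} → IsQuiver M → MutationCyclic M → (s : Fin 3) →
  ∃₂ λ k p → Triangle M k s p
triangle-through {M} isQ@(_ , no-2-cycle) cyclic s with others s
... | y , z , (s≢y , y≢z , s≢z) with no-2-cycle s y
...   | inj₁ s↛y = y , z , triangle isQ cyclic (≢-sym s≢y , s≢z , y≢z) s↛y
...   | inj₂ y↛s = z , y , triangle isQ cyclic (≢-sym s≢z , s≢y , ≢-sym y≢z)
                     (proj₂ (cyclic-orientation isQ (cyclic []) (s≢y , y≢z , s≢z) y↛s))

-- Ice quivers

mutablePart : {n : ℕ} → Quiver (IceV n) → Quiver (Fin n)
mutablePart R i j = R (inj₁ i) (inj₁ j)

Green : {n : ℕ} → Quiver (IceV n) → Fin n → Set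
Green R v = ∀ t → R (inj₂ t) (inj₁ v) ≡ 0

module _ {n : ℕ} where
  private
    module Mᴵₙ = Mutation (_≟ᴵ_ {n})
    module Mᶠₙ = Mutation (_≟ᶠ_ {n})

  mutablePart-isQuiver : {R : Quiver (IceV n)} → IsQuiver R → IsQuiver (mutablePart R)
  mutablePart-isQuiver (loop-free , no-2-cycle) =
    (λ i → loop-free (inj₁ i)) , (λ i j → no-2-cycle (inj₁ i) (inj₁ j))

  mutablePart-mutate : (R : Quiver (IceV n)) (k : Fin n) →
    mutablePart (mutate _≟ᴵ_ R (inj₁ k)) ≈ mutate _≟ᶠ_ (mutablePart R) k
  mutablePart-mutate R k a b = by-cases (a ≟ᶠ k) (b ≟ᶠ k)
    where
    by-cases : Dec (a ≡ k) → Dec (b ≡ k) →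
      mutate _≟ᴵ_ R (inj₁ k) (inj₁ a) (inj₁ b) ≡ mutate _≟ᶠ_ (mutablePart R) k a b
    by-cases (yes refl) _          =
      trans (Mᴵₙ.mutate-out R (inj₁ a) (inj₁ b)) (sym (Mᶠₙ.mutate-out (mutablePart R) a b))
    by-cases (no _)     (yes refl) =
      trans (Mᴵₙ.mutate-in R (inj₁ b) (inj₁ a)) (sym (Mᶠₙ.mutate-in (mutablePart R) b a))
    by-cases (no a≢k)   (no b≢k)   =
      trans (Mᴵₙ.mutate-away R (a≢k ∘ inj₁-injective) (b≢k ∘ inj₁-injective))
            (sym (Mᶠₙ.mutate-away (mutablePart R) a≢k b≢k))

  framed-isQuiver : {Q : Quiver (Fin n)} → IsQuiver Q → IsQuiver (framed Q)
  framed-isQuiver {Q} (loop-free , no-2-cycle) = loop-free′ , no-2-cycle′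
    where
    loop-free′ : ∀ a → framed Q a a ≡ 0
    loop-free′ (inj₁ i) = loop-free i
    loop-free′ (inj₂ _) = refl
    no-2-cycle′ : ∀ a b → framed Q a b ≡ 0 ⊎ framed Q b a ≡ 0
    no-2-cycle′ (inj₁ i) (inj₁ j) = no-2-cycle i j
    no-2-cycle′ (inj₁ _) (inj₂ _) = inj₂ refl
    no-2-cycle′ (inj₂ _) _        = inj₁ refl

  framed-green : (Q : Quiver (Fin n)) (v : Fin n) → Green (framed Q) v
  framed-green _ _ _ = refl

  Green-resp-≈ : {R R′ : Quiver (IceV n)} {v : Fin n} → R ≈ R′ → Green R v → Green R′ v
  Green-resp-≈ R≈R′ green t = trans (sym (R≈R′ _ _)) (green t)

  green⇒¬red : {R : Quiver (IceV n)} {v : Fin n} → Green R v → ¬ Red R v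
  green⇒¬red green ((t , inj₁ t→v) , _)       = >⇒≢ t→v (green t)
  green⇒¬red _     ((t , inj₂ v→t) , v↛frozen) = >⇒≢ v→t (v↛frozen t)

mutationCyclic-mutate : {R : Quiver (IceV 3)} (k : Fin 3) →
  MutationCyclic (mutablePart R) → MutationCyclic (mutablePart (mutate _≟ᴵ_ R (inj₁ k)))
mutationCyclic-mutate {R} k cyclic ws =
  cyclic (k ∷ ws) ∘ Acyclic-resp-≈ (Mᶠ.mutateSeq-resp-≈ ws (mutablePart-mutate R k))

-- Seeds along a reduced mutation sequence

open Mutation (_≟ᴵ_ {3})

IceQ3 : Set
IceQ3 = Quiver (IceV 3)

-- With x_v = #(v → t′) − #(t′ → v), the first case says x_k ≤ 0 and −x_k ≤ x_s,
-- the second says 0 ≤ x_k ≤ −x_p.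
data Column (R : IceQ3) (k s p t : Fin 3) : Set where
  s-dominates : R (inj₁ k) (inj₂ t) ≡ 0 →
    R (inj₂ t) (inj₁ k) ≤ R (inj₁ s) (inj₂ t) → Column R k s p t
  p-dominates : R (inj₂ t) (inj₁ k) ≡ 0 → R (inj₁ p) (inj₂ t) ≡ 0 →
    R (inj₁ k) (inj₂ t) ≤ R (inj₂ t) (inj₁ p) → Column R k s p t

-- The invariant along a reduced mutation sequence whose last mutation was at k.
record Seed (R : IceQ3) (k s p : Fin 3) : Set where
  field
    isQuiver : IsQuiver R
    mutationCyclic : MutationCyclic (mutablePart R)
    cycle : Triangle (mutablePart R) k s p
    s-green : Green R s
    column : ∀ t → Column R k s p t

-- What a column needs for mutation at s, resp. at p, to produce a column of the first,
-- resp. second, kind.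
MiddleBound : IceQ3 → Fin 3 → Fin 3 → Fin 3 → Set
MiddleBound R k s t =
  R (inj₁ s) (inj₂ t) + R (inj₂ t) (inj₁ k)
    ≤ R (inj₁ k) (inj₂ t) + R (inj₁ k) (inj₁ s) * R (inj₁ s) (inj₂ t)

mutate-middle : {R : IceQ3} {k s p : Fin 3} → IsQuiver R → MutationCyclic (mutablePart R) →
  Triangle (mutablePart R) k s p → Green R s → (∀ t → MiddleBound R k s t) →
  Seed (mutate _≟ᴵ_ R (inj₁ s)) s k p
mutate-middle {R} {k} {s} {p} isQ cyclic tri s-green bound = record
  { isQuiver = mutate-isQuiver (inj₁ s) isQ
  ; mutationCyclic = mutationCyclic-mutate s cyclic
  ; cycle = triangle (mutablePart-isQuiver (mutate-isQuiver (inj₁ s) isQ))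
      (mutationCyclic-mutate s cyclic)
      (≢-sym k≢s , k≢p , s≢p) (trans (mutate-in R (inj₁ s) (inj₁ k)) (Triangle.s↛k tri))
  ; s-green = k-green
  ; column = λ t → s-dominates (trans (mutate-out R (inj₁ s) (inj₂ t)) (s-green t)) (s-below-k t) }
  where
  open Triangle tri using (distinct)
  k≢s = proj₁ distinct
  s≢p = proj₁ (proj₂ distinct)
  k≢p = proj₂ (proj₂ distinct)
  k≢s′ : inj₁ k ≢ inj₁ s
  k≢s′ = k≢s ∘ inj₁-injective
  k-green : Green (mutate _≟ᴵ_ R (inj₁ s)) k
  k-green t rewrite mutate-away R {inj₁ s} {inj₂ t} {inj₁ k} (λ ()) k≢s′ | s-green t
    | +-identityʳ (R (inj₂ t) (inj₁ k)) = m≤n⇒m∸n≡0 (m+n≤o⇒n≤o _ (bound t))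
  s-below-k : ∀ t → mutate _≟ᴵ_ R (inj₁ s) (inj₂ t) (inj₁ s) ≤ mutate _≟ᴵ_ R (inj₁ s) (inj₁ k) (inj₂ t)
  s-below-k t rewrite mutate-in R (inj₁ s) (inj₂ t)
    | mutate-away R {inj₁ s} {inj₁ k} {inj₂ t} k≢s′ (λ ()) | s-green t | +-identityʳ (R (inj₂ t) (inj₁ k)) =
    m+n≤o⇒m≤o∸n _ (bound t)

green-middle-bound : {R : IceQ3} {k s : Fin 3} (t : Fin 3) → R (inj₂ t) (inj₁ k) ≡ 0 →
  2 ≤ R (inj₁ k) (inj₁ s) → MiddleBound R k s t
green-middle-bound {R} {k} {s} t t↛k 2≤a rewrite t↛k =
  ≤-trans (≤-reflexive (+-identityʳ y))
    (≤-trans (n≤a*n y (<⇒≤ 2≤a)) (m≤n+m _ (R (inj₁ k) (inj₂ t))))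
  where y = R (inj₁ s) (inj₂ t)

column-middle-bound : {R : IceQ3} {k s p t : Fin 3} → Column R k s p t →
  2 ≤ R (inj₁ k) (inj₁ s) → MiddleBound R k s t
column-middle-bound {R} {k} {s} {t = t} (s-dominates k↛t t→k≤s→t) 2≤a rewrite k↛t =
  ≤-trans (+-monoʳ-≤ (R (inj₁ s) (inj₂ t)) t→k≤s→t) (n+n≤a*n _ 2≤a)
column-middle-bound {R} {k} {s} {t = t} (p-dominates t↛k _ _) 2≤a =
  green-middle-bound {R} {k} {s} t t↛k 2≤a

LastBound : IceQ3 → Fin 3 → Fin 3 → Fin 3 → Set
LastBound R k p t =
  R (inj₂ t) (inj₁ p) + R (inj₁ k) (inj₂ t)
    ≤ R (inj₂ t) (inj₁ k) + R (inj₂ t) (inj₁ p) * R (inj₁ p) (inj₁ k)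

seed-mutate-last : {R : IceQ3} {k s p : Fin 3} → Seed R k s p → Seed (mutate _≟ᴵ_ R (inj₁ p)) p s k
seed-mutate-last {R} {k} {s} {p} seed = record
  { isQuiver = mutate-isQuiver (inj₁ p) isQuiver
  ; mutationCyclic = mutationCyclic-mutate p mutationCyclic
  ; cycle = triangle (mutablePart-isQuiver (mutate-isQuiver (inj₁ p) isQuiver))
      (mutationCyclic-mutate p mutationCyclic)
      (≢-sym s≢p , ≢-sym k≢s , ≢-sym k≢p) (trans (mutate-in R (inj₁ p) (inj₁ s)) p↛s)
  ; s-green = s-green′
  ; column = column′ }
  where
  open Seed seed
  open Triangle cycle
  N = mutate _≟ᴵ_ R (inj₁ p)
  k≢s = proj₁ distinct
  s≢p = proj₁ (proj₂ distinct)
  k≢p = proj₂ (proj₂ distinct)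
  s≢p′ : inj₁ s ≢ inj₁ p
  s≢p′ = s≢p ∘ inj₁-injective
  k≢p′ : inj₁ k ≢ inj₁ p
  k≢p′ = k≢p ∘ inj₁-injective

  s-green′ : Green N s
  s-green′ t rewrite mutate-away R {inj₁ p} {inj₂ t} {inj₁ s} (λ ()) s≢p′ | s-green t | p↛s
    | *-zeroʳ (R (inj₂ t) (inj₁ p)) =
      0∸n≡0 (R (inj₁ s) (inj₂ t) + R (inj₁ s) (inj₁ p) * R (inj₁ p) (inj₂ t))

  s-dominated-after : ∀ t → R (inj₂ t) (inj₁ p) ≡ 0 → Column N p s k t
  s-dominated-after t t↛p = s-dominates (trans (mutate-out R (inj₁ p) (inj₂ t)) t↛p) p-below-s
    where
    p-below-s : N (inj₂ t) (inj₁ p) ≤ N (inj₁ s) (inj₂ t)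
    p-below-s rewrite mutate-in R (inj₁ p) (inj₂ t)
      | mutate-away R {inj₁ p} {inj₁ s} {inj₂ t} s≢p′ (λ ()) | s-green t | t↛p =
      ≤-trans (n≤a*n (R (inj₁ p) (inj₂ t)) (<⇒≤ 2≤s→p)) (m≤n+m _ (R (inj₁ s) (inj₂ t)))

  p-dominated-after : ∀ t → R (inj₁ p) (inj₂ t) ≡ 0 → LastBound R k p t → Column N p s k t
  p-dominated-after t p↛t bound = p-dominates (trans (mutate-in R (inj₁ p) (inj₂ t)) p↛t) k↛t p-below-k
    where
    k↛t : N (inj₁ k) (inj₂ t) ≡ 0
    k↛t rewrite mutate-away R {inj₁ p} {inj₁ k} {inj₂ t} k≢p′ (λ ()) | k↛p
      | +-identityʳ (R (inj₁ k) (inj₂ t)) = m≤n⇒m∸n≡0 (m+n≤o⇒n≤o _ bound)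
    p-below-k : N (inj₁ p) (inj₂ t) ≤ N (inj₂ t) (inj₁ k)
    p-below-k rewrite mutate-out R (inj₁ p) (inj₂ t)
      | mutate-away R {inj₁ p} {inj₂ t} {inj₁ k} (λ ()) k≢p′ | k↛p | +-identityʳ (R (inj₁ k) (inj₂ t)) =
      m+n≤o⇒m≤o∸n _ bound

  column′ : ∀ t → Column N p s k t
  column′ t with column t
  ... | p-dominates t↛k p↛t k→t≤t→p = p-dominated-after t p↛t bound
    where
    u = R (inj₂ t) (inj₁ p)
    bound : LastBound R k p t
    bound rewrite t↛k = ≤-trans (+-monoʳ-≤ u k→t≤t→p) (n+n≤n*a u 2≤p→k)
  ... | s-dominates k↛t _ with proj₂ isQuiver (inj₁ p) (inj₂ t)
  ...   | inj₂ t↛p = s-dominated-after t t↛p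
  ...   | inj₁ p↛t = p-dominated-after t p↛t bound
    where
    u = R (inj₂ t) (inj₁ p)
    bound : LastBound R k p t
    bound rewrite k↛t = ≤-trans (≤-reflexive (+-identityʳ u))
      (≤-trans (subst (u ≤_) (*-comm _ u) (n≤a*n u (<⇒≤ 2≤p→k))) (m≤n+m _ (R (inj₂ t) (inj₁ k))))

seed-mutate-middle : {R : IceQ3} {k s p : Fin 3} → Seed R k s p → Seed (mutate _≟ᴵ_ R (inj₁ s)) s k p
seed-mutate-middle seed = mutate-middle isQuiver mutationCyclic cycle s-green
  (λ t → column-middle-bound (column t) (Triangle.2≤k→s cycle))
  where open Seed seed

seed-mutate : {R : IceQ3} {k s p v : Fin 3} → Seed R k s p → v ≢ k →
  ∃₂ λ s′ p′ → Seed (mutate _≟ᴵ_ R (inj₁ v)) v s′ p′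
seed-mutate seed v≢k with covers (Triangle.distinct (Seed.cycle seed)) _
... | inj₁ v≡k         = ⊥-elim (v≢k v≡k)
... | inj₂ (inj₁ refl) = _ , _ , seed-mutate-middle seed
... | inj₂ (inj₂ refl) = _ , _ , seed-mutate-last seed

green-after : {R : IceQ3} {k s p : Fin 3} {ws : List (Fin 3)} → Seed R k s p → Linked _≢_ (k ∷ ws) →
  ∃ λ v → Green (mutateIce ws R) v
green-after {s = s} seed [-]              = s , Seed.s-green seed
green-after         seed (k≢v ∷ reduced) with seed-mutate seed (≢-sym k≢v)
... | _ , _ , seed′ = green-after seed′ reduced

first-seed : {Q : Q3} → IsQuiver Q → MutationCyclic Q → (k : Fin 3) →
  ∃₂ λ s p → Seed (mutate _≟ᴵ_ (framed Q) (inj₁ k)) k s p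
first-seed {Q} isQ cyclic k with triangle-through isQ cyclic k
... | k₀ , p₀ , tri = k₀ , p₀ , mutate-middle (framed-isQuiver isQ) cyclic tri (framed-green Q k)
  (λ t → green-middle-bound {framed Q} {k₀} {k} t refl (Triangle.2≤k→s tri))

green-after-reduced : {Q : Q3} → IsQuiver Q → MutationCyclic Q → {ws : List (Fin 3)} →
  Linked _≢_ ws → ∃ λ v → Green (mutateIce ws (framed Q)) v
green-after-reduced {Q} _ _ [] = zero , framed-green Q zero
green-after-reduced isQ cyclic {k ∷ _} reduced with first-seed isQ cyclic k
... | _ , _ , seed = green-after seed reduced

open Reduction _≟ᶠ_ (_≟ᴵ_ {3}) inj₁

lemma5p8 : (Q : Q3) → IsQuiver Q → MutationCyclic Q →
    ((ws : List (Fin 3)) → ¬ AllRed (mutateIce ws (framed Q)))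
    × ¬ AdmitsReddeningSequence Q
lemma5p8 Q isQ cyclic = not-all-red , λ (ws , all-red) → not-all-red ws all-red
  where
  not-all-red : (ws : List (Fin 3)) → ¬ AllRed (mutateIce ws (framed Q))
  not-all-red ws all-red with green-after-reduced isQ cyclic (reduce-linked ws)
  ... | v , green = green⇒¬red {R = mutateIce ws (framed Q)}
    (Green-resp-≈ (≈-sym (mutateSeq-reduce ws (framed-isQuiver isQ))) green) (all-red v)
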